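{- For each $n\ge 0$, \[ \hat{B}^{\circ}_n(s,t)=\frac{1}{n!}\sum_{k=0}^n(-1)^{n-k}{n\brack k}\,\bigl|\mathrm{Bal}^s[k]\bigr|\,\bigl|\mathrm{Bal}^t[k]\bigr|. \]
   Context: A binary Burge matrix is a matrix with entries in $\{0,1\}$ in which every row and every column has a nonzero entry; its size is the number of ones; $\mathcal{M}^{01}[n]$ is the set of binary Burge matrices of size $n$. For indeterminates $s,t$, $\hat{B}^{\circ}_n(s,t)=\sum_{A\in\mathcal{M}^{01}[n]}s^{\mathrm{row}(A)}t^{\mathrm{col}(A)}$, where $\mathrm{row}(A),\mathrm{col}(A)$ are the numbers of rows and columns. A ballot of $[k]$ is an ordered set partition (sequence of disjoint nonempty sets with union $[k]$); $|\mathrm{Bal}^t[k]|=\sum_w t^{\mathrm{blocks}(w)}$ over all ballots $w$ of $[k]$, where $\mathrm{blocks}(w)$ is the number of blocks. ${n\brack k}$ is the unsigned Stirling number of the first kind. -}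

module Defs where

open import Data.Bool using (Bool; true; false; _∧_; _∨_; if_then_else_)
open import Data.Nat as ℕ using (ℕ; zero; suc)
open import Data.Integer as ℤ using (ℤ; +_; -_; _+_; _*_; _^_)
open import Data.Fin as Fin using (Fin)
open import Data.Fin.Properties using (_≟_)
open import Data.List as List using (List; []; _∷_; length; filterᵇ; concatMap; allFin)
open import Data.Vec as Vec using (Vec; []; _∷_)
open import Relation.Nullary.Decidable using (⌊_⌋)

vecs : {A : Set} → (n : ℕ) → List A → List (Vec A n)
vecs zero    xs = [] ∷ []
vecs (suc n) xs = concatMap (λ x → List.map (x ∷_) (vecs n xs)) xs

Σ≤ : ℕ → (ℕ → ℤ) → ℤ
Σ≤ zero    f = f zero
Σ≤ (suc n) f = Σ≤ n f + f (suc n)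

Matrix01 : ℕ → ℕ → Set
Matrix01 r c = Vec (Vec Bool c) r

allMatrices : (r c : ℕ) → List (Matrix01 r c)
allMatrices r c = vecs r (vecs c (true ∷ false ∷ []))

anyTrue : {n : ℕ} → Vec Bool n → Bool
anyTrue = Vec.foldr _ _∨_ false

allTrue : {n : ℕ} → Vec Bool n → Bool
allTrue = Vec.foldr _ _∧_ true

countOnes : {n : ℕ} → Vec Bool n → ℕ
countOnes = Vec.foldr _ (λ b k → if b then suc k else k) 0

size : {r c : ℕ} → Matrix01 r c → ℕ
size m = Vec.sum (Vec.map countOnes m)

isBurgeOfSize : {r c : ℕ} → ℕ → Matrix01 r c → Bool
isBurgeOfSize n m =
  allTrue (Vec.map anyTrue m) ∧ allTrue (Vec.map anyTrue (Vec.transpose m))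
  ∧ ⌊ size m ℕ.≟ n ⌋

burgeCount : ℕ → ℕ → ℕ → ℕ
burgeCount n r c = length (filterᵇ (isBurgeOfSize n) (allMatrices r c))

-- \hat B^∘_n(s,t); rows and columns of a Burge matrix of size n are ≤ n
Bhat : ℕ → ℤ → ℤ → ℤ
Bhat n s t = Σ≤ n (λ r → Σ≤ n (λ c → + burgeCount n r c * (s ^ r) * (t ^ c)))

-- a ballot of [k] with b blocks is encoded by its block-assignment map
-- Fin k → Fin b (element ↦ index of its block), which must be surjective
-- (blocks are nonempty); maps are vectors of length k.
isSurj : {k b : ℕ} → Vec (Fin b) k → Bool
isSurj {k} {b} v =
  List.foldr (λ j acc → Vec.foldr _ (λ i a → ⌊ j ≟ i ⌋ ∨ a) false v ∧ acc) true (allFin b)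

ballotCount : ℕ → ℕ → ℕ
ballotCount k b = length (filterᵇ isSurj (vecs k (allFin b)))

-- |Bal^t[k]| = Σ_b (#ballots of [k] with b blocks) t^b ; b ≤ k
Bal : ℕ → ℤ → ℤ
Bal k t = Σ≤ k (λ b → + ballotCount k b * (t ^ b))

stirling1 : ℕ → ℕ → ℕ
stirling1 zero    zero    = 1
stirling1 zero    (suc k) = 0
stirling1 (suc n) zero    = 0
stirling1 (suc n) (suc k) = n ℕ.* stirling1 n (suc k) ℕ.+ stirling1 n k

rhsTimesFact : ℕ → ℤ → ℤ → ℤ
rhsTimesFact n s t =
  Σ≤ n (λ k → ((- + 1) ^ (n ℕ.∸ k)) * + stirling1 n k * Bal k s * Bal k t)

-- A ballot of [k] with b blocks is a surjection [k] → [b], and a binary Burge matrix with r rows and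
-- c columns is a 0/1 matrix without zero rows or columns.  Inclusion–exclusion over the set S of
-- blocks missed by a map, resp. over the sets S, T of rows and columns forced to vanish, gives
--   #ballots(k, b)  = Σ_S (-1)^|S| (b - |S|)^k,
--   #Burge(n, r, c) = Σ_{S,T} (-1)^(|S|+|T|) C((r - |S|)(c - |T|), n).
-- The signed Stirling numbers of the first kind are the coefficients of the falling factorial,
-- Σ_k (-1)^(n-k) [n k] x^k = x(x-1)⋯(x-n+1) = n! C(x, n), so summing the product of two ballot
-- formulas against them turns (r - |S|)^k (c - |T|)^k into n! C((r - |S|)(c - |T|), n): the
-- coefficient of s^r t^c on the right-hand side is n! #Burge(n, r, c).  There are no ballots with
-- more blocks than elements, so every sum may be taken over 0..n.

module Submission where

open import Defs
open import Data.Nat using (ℕ; _!)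
open import Data.Integer using (ℤ; +_; _*_)
open import Relation.Binary.PropositionalEquality using (_≡_)

open import Data.Bool using (Bool; true; false; _∧_; _∨_; not; if_then_else_; T)
open import Data.Bool.Properties using (T-∧; T-≡)
open import Data.Fin using (Fin; zero; suc)
open import Data.Fin.Properties using (_≟_; injective⇒≤)
open import Data.Integer using (_+_; _-_; -_; _^_; 0ℤ; 1ℤ; -1ℤ)
import Data.Integer.Properties as ℤₚ
open import Data.Integer.Tactic.RingSolver using (solve-∀)
open import Data.List as List
  using (List; []; _∷_; _++_; length; filterᵇ; concatMap; tabulate; allFin)
open import Data.List.Properties using (map-tabulate)
open import Data.Nat as ℕ using (zero; suc; _≤_; _<_; _≤′_; ≤′-refl; ≤′-step; s≤s)
import Data.Nat.Properties as ℕₚ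
open import Data.Nat.Combinatorics using (_C_; nCk+nC[k+1]≡[n+1]C[k+1]; nC1≡n)
open import Data.Nat.Tactic.RingSolver using () renaming (solve-∀ to ℕ-solve-∀)
open import Data.Product using (∃; _,_; proj₁; proj₂)
open import Data.Vec as Vec using (Vec; []; _∷_; lookup)
import Data.Vec.Properties as Vecₚ
open import Function using (_∘_; Equivalence)
open import Relation.Binary.PropositionalEquality
  using (_≢_; refl; sym; trans; cong; cong₂; module ≡-Reasoning)
open import Relation.Nullary using (contradiction)
open import Relation.Nullary.Decidable
  using (⌊_⌋; yes; no; dec-true; dec-false; isYes≗does; ⌊⌋-map′)
open import Algebra.Properties.CommutativeMonoid.Sum ℤₚ.*-1-commutativeMonoid
  using ()
  renaming (sum to product; sum-cong-≗ to ∏-cong; ∑-distrib-+ to ∏-distrib-*;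
            ∑-comm to ∏-comm; sum-replicate-zero to ∏-one)
open import Algebra.Properties.CommutativeSemigroup ℤₚ.+-commutativeSemigroup
  using () renaming (interchange to +-interchange)
open import Algebra.Properties.CommutativeSemigroup ℤₚ.*-commutativeSemigroup
  using (x∙yz≈y∙xz) renaming (interchange to *-interchange)

open ≡-Reasoning

private
  variable
    A B : Set

-- Finite sums and products

𝟙 : Bool → ℤ
𝟙 true  = 1ℤ
𝟙 false = 0ℤ

𝟙-∧ : ∀ a b → 𝟙 (a ∧ b) ≡ 𝟙 a * 𝟙 b
𝟙-∧ true  b = sym (ℤₚ.*-identityˡ (𝟙 b))
𝟙-∧ false b = refl

𝟙-∨ : ∀ a b → 𝟙 (a ∨ b) ≡ 1ℤ - (1ℤ - 𝟙 a) * (1ℤ - 𝟙 b)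
𝟙-∨ true  b     = refl
𝟙-∨ false true  = refl
𝟙-∨ false false = refl

∑ : List A → (A → ℤ) → ℤ
∑ []       f = 0ℤ
∑ (x ∷ xs) f = f x + ∑ xs f

infixr 5 ∑
syntax ∑ xs (λ x → e) = ∑[ x ∈ xs ] e

∑-cong : ∀ (xs : List A) {f g : A → ℤ} → (∀ x → f x ≡ g x) → ∑ xs f ≡ ∑ xs g
∑-cong []       eq = refl
∑-cong (x ∷ xs) eq = cong₂ _+_ (eq x) (∑-cong xs eq)

∑-zero : ∀ (xs : List A) → ∑[ x ∈ xs ] 0ℤ ≡ 0ℤ
∑-zero []       = refl
∑-zero (x ∷ xs) = trans (ℤₚ.+-identityˡ _) (∑-zero xs)

∑-distrib-+ : ∀ (xs : List A) (f g : A → ℤ) → ∑[ x ∈ xs ] (f x + g x) ≡ ∑ xs f + ∑ xs g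
∑-distrib-+ []       f g = refl
∑-distrib-+ (x ∷ xs) f g =
  trans (cong (_+_ (f x + g x)) (∑-distrib-+ xs f g)) (+-interchange (f x) (g x) _ _)

*-distribˡ-∑ : ∀ c (xs : List A) (f : A → ℤ) → c * ∑ xs f ≡ ∑[ x ∈ xs ] (c * f x)
*-distribˡ-∑ c []       f = ℤₚ.*-zeroʳ c
*-distribˡ-∑ c (x ∷ xs) f =
  trans (ℤₚ.*-distribˡ-+ c (f x) _) (cong (_+_ (c * f x)) (*-distribˡ-∑ c xs f))

*-distribʳ-∑ : ∀ c (xs : List A) (f : A → ℤ) → ∑ xs f * c ≡ ∑[ x ∈ xs ] (f x * c)
*-distribʳ-∑ c []       f = ℤₚ.*-zeroˡ c
*-distribʳ-∑ c (x ∷ xs) f =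
  trans (ℤₚ.*-distribʳ-+ c (f x) _) (cong (_+_ (f x * c)) (*-distribʳ-∑ c xs f))

*-distribˡ-∑∑ : ∀ c (xs : List A) (ys : List B) (f : A → B → ℤ) →
                c * (∑[ x ∈ xs ] ∑[ y ∈ ys ] f x y) ≡ ∑[ x ∈ xs ] ∑[ y ∈ ys ] c * f x y
*-distribˡ-∑∑ c xs ys f =
  trans (*-distribˡ-∑ c xs _) (∑-cong xs (λ x → *-distribˡ-∑ c ys (f x)))

∑-comm : ∀ (xs : List A) (ys : List B) (f : A → B → ℤ) →
         ∑[ x ∈ xs ] ∑[ y ∈ ys ] f x y ≡ ∑[ y ∈ ys ] ∑[ x ∈ xs ] f x y
∑-comm []       ys f = sym (∑-zero ys)
∑-comm (x ∷ xs) ys f =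
  trans (cong (_+_ (∑ ys (f x))) (∑-comm xs ys f)) (sym (∑-distrib-+ ys (f x) _))

∑-product : ∀ (xs : List A) (ys : List B) (f : A → ℤ) (g : B → ℤ) →
            ∑ xs f * ∑ ys g ≡ ∑[ x ∈ xs ] ∑[ y ∈ ys ] f x * g y
∑-product xs ys f g =
  trans (*-distribʳ-∑ _ xs f) (∑-cong xs (λ x → *-distribˡ-∑ (f x) ys g))

∑-++ : ∀ (xs ys : List A) (f : A → ℤ) → ∑ (xs ++ ys) f ≡ ∑ xs f + ∑ ys f
∑-++ []       ys f = sym (ℤₚ.+-identityˡ _)
∑-++ (x ∷ xs) ys f = trans (cong (_+_ (f x)) (∑-++ xs ys f)) (sym (ℤₚ.+-assoc (f x) _ _))

∑-map : ∀ (h : A → B) (xs : List A) (f : B → ℤ) → ∑ (List.map h xs) f ≡ ∑[ x ∈ xs ] f (h x)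
∑-map h []       f = refl
∑-map h (x ∷ xs) f = cong (_+_ (f (h x))) (∑-map h xs f)

∑-concatMap : ∀ (h : A → List B) (xs : List A) (f : B → ℤ) →
              ∑ (concatMap h xs) f ≡ ∑[ x ∈ xs ] ∑ (h x) f
∑-concatMap h []       f = refl
∑-concatMap h (x ∷ xs) f =
  trans (∑-++ (h x) _ f) (cong (_+_ (∑ (h x) f)) (∑-concatMap h xs f))

∑-vecs-suc : ∀ n (xs : List A) (f : Vec A (suc n) → ℤ) →
             ∑ (vecs (suc n) xs) f ≡ ∑[ x ∈ xs ] ∑[ v ∈ vecs n xs ] f (x ∷ v)
∑-vecs-suc n xs f =
  trans (∑-concatMap _ xs f) (∑-cong xs (λ x → ∑-map (x ∷_) (vecs n xs) f))

∑-tabulate : ∀ n (h : Fin n → A) (f : A → ℤ) → ∑ (tabulate h) f ≡ ∑[ i ∈ allFin n ] f (h i)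
∑-tabulate n h f =
  trans (cong (λ xs → ∑ xs f) (sym (map-tabulate (λ i → i) h))) (∑-map h (allFin n) f)

length-filterᵇ : ∀ (p : A → Bool) (xs : List A) → + length (filterᵇ p xs) ≡ ∑[ x ∈ xs ] 𝟙 (p x)
length-filterᵇ p []       = refl
length-filterᵇ p (x ∷ xs) with p x
... | true  = cong (_+_ 1ℤ) (length-filterᵇ p xs)
... | false = trans (length-filterᵇ p xs) (sym (ℤₚ.+-identityˡ _))

Σ≤-cong : ∀ n {f g : ℕ → ℤ} → (∀ i → f i ≡ g i) → Σ≤ n f ≡ Σ≤ n g
Σ≤-cong zero    eq = eq zero
Σ≤-cong (suc n) eq = cong₂ _+_ (Σ≤-cong n eq) (eq (suc n))

Σ≤-cong-≤ : ∀ n {f g : ℕ → ℤ} → (∀ i → i ≤ n → f i ≡ g i) → Σ≤ n f ≡ Σ≤ n g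
Σ≤-cong-≤ zero    eq = eq zero ℕ.z≤n
Σ≤-cong-≤ (suc n) eq =
  cong₂ _+_ (Σ≤-cong-≤ n (λ i i≤n → eq i (ℕₚ.m≤n⇒m≤1+n i≤n))) (eq (suc n) ℕₚ.≤-refl)

Σ≤-distrib-+ : ∀ n (f g : ℕ → ℤ) → Σ≤ n (λ i → f i + g i) ≡ Σ≤ n f + Σ≤ n g
Σ≤-distrib-+ zero    f g = refl
Σ≤-distrib-+ (suc n) f g =
  trans (cong (_+ (f (suc n) + g (suc n))) (Σ≤-distrib-+ n f g))
        (+-interchange (Σ≤ n f) (Σ≤ n g) (f (suc n)) (g (suc n)))

*-distribˡ-Σ≤ : ∀ c n (f : ℕ → ℤ) → c * Σ≤ n f ≡ Σ≤ n (λ i → c * f i)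
*-distribˡ-Σ≤ c zero    f = refl
*-distribˡ-Σ≤ c (suc n) f =
  trans (ℤₚ.*-distribˡ-+ c (Σ≤ n f) (f (suc n))) (cong (_+ c * f (suc n)) (*-distribˡ-Σ≤ c n f))

*-distribʳ-Σ≤ : ∀ c n (f : ℕ → ℤ) → Σ≤ n f * c ≡ Σ≤ n (λ i → f i * c)
*-distribʳ-Σ≤ c zero    f = refl
*-distribʳ-Σ≤ c (suc n) f =
  trans (ℤₚ.*-distribʳ-+ c (Σ≤ n f) (f (suc n))) (cong (_+ f (suc n) * c) (*-distribʳ-Σ≤ c n f))

Σ≤-comm : ∀ n m (f : ℕ → ℕ → ℤ) → Σ≤ n (λ i → Σ≤ m (f i)) ≡ Σ≤ m (λ j → Σ≤ n (λ i → f i j))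
Σ≤-comm zero    m f = refl
Σ≤-comm (suc n) m f =
  trans (cong (_+ Σ≤ m (f (suc n))) (Σ≤-comm n m f)) (sym (Σ≤-distrib-+ m _ _))

Σ≤-∑-comm : ∀ n (xs : List A) (f : ℕ → A → ℤ) →
            Σ≤ n (λ i → ∑ xs (f i)) ≡ ∑[ x ∈ xs ] Σ≤ n (λ i → f i x)
Σ≤-∑-comm zero    xs f = refl
Σ≤-∑-comm (suc n) xs f =
  trans (cong (_+ ∑ xs (f (suc n))) (Σ≤-∑-comm n xs f)) (sym (∑-distrib-+ xs _ _))

Σ≤-suc : ∀ n (f : ℕ → ℤ) → Σ≤ (suc n) f ≡ f zero + Σ≤ n (f ∘ suc)
Σ≤-suc zero    f = refl
Σ≤-suc (suc n) f =
  trans (cong (_+ f (suc (suc n))) (Σ≤-suc n f)) (ℤₚ.+-assoc (f zero) _ _)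

Σ≤-extend : ∀ {n m} (f : ℕ → ℤ) → n ≤ m → (∀ i → n < i → f i ≡ 0ℤ) → Σ≤ n f ≡ Σ≤ m f
Σ≤-extend {n} f n≤m vanishes = go (ℕₚ.≤⇒≤′ n≤m)
  where
  go : ∀ {m} → n ≤′ m → Σ≤ n f ≡ Σ≤ m f
  go ≤′-refl            = refl
  go (≤′-step {m} n≤′m) = begin
    Σ≤ n f              ≡⟨ go n≤′m ⟩
    Σ≤ m f              ≡⟨ ℤₚ.+-identityʳ _ ⟨
    Σ≤ m f + 0ℤ         ≡⟨ cong (_+_ (Σ≤ m f)) (vanishes (suc m) (s≤s (ℕₚ.≤′⇒≤ n≤′m))) ⟨
    Σ≤ m f + f (suc m)  ∎

Σ≤-bilinear : ∀ n m (w : ℕ → ℤ) (f g : ℕ → ℕ → ℤ) →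
  Σ≤ n (λ k → w k * Σ≤ m (f k) * Σ≤ m (g k))
    ≡ Σ≤ m (λ i → Σ≤ m (λ j → Σ≤ n (λ k → w k * f k i * g k j)))
Σ≤-bilinear n m w f g = begin
  Σ≤ n (λ k → w k * Σ≤ m (f k) * Σ≤ m (g k))                    ≡⟨ Σ≤-cong n expand ⟩
  Σ≤ n (λ k → Σ≤ m (λ i → Σ≤ m (λ j → w k * f k i * g k j)))   ≡⟨ Σ≤-comm n m _ ⟩
  Σ≤ m (λ i → Σ≤ n (λ k → Σ≤ m (λ j → w k * f k i * g k j)))   ≡⟨ Σ≤-cong m (λ i → Σ≤-comm n m _) ⟩
  Σ≤ m (λ i → Σ≤ m (λ j → Σ≤ n (λ k → w k * f k i * g k j)))   ∎
  where
  expand : ∀ k → w k * Σ≤ m (f k) * Σ≤ m (g k) ≡ Σ≤ m (λ i → Σ≤ m (λ j → w k * f k i * g k j))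
  expand k = begin
    w k * Σ≤ m (f k) * Σ≤ m (g k)
      ≡⟨ cong (_* Σ≤ m (g k)) (*-distribˡ-Σ≤ (w k) m (f k)) ⟩
    Σ≤ m (λ i → w k * f k i) * Σ≤ m (g k)
      ≡⟨ *-distribʳ-Σ≤ _ m _ ⟩
    Σ≤ m (λ i → w k * f k i * Σ≤ m (g k))
      ≡⟨ Σ≤-cong m (λ i → *-distribˡ-Σ≤ (w k * f k i) m (g k)) ⟩
    Σ≤ m (λ i → Σ≤ m (λ j → w k * f k i * g k j)) ∎

∏ : (n : ℕ) → (Fin n → ℤ) → ℤ
∏ n f = product f

infixr 5 ∏
syntax ∏ n (λ i → e) = ∏[ i < n ] e

∏-const : ∀ n x → ∏[ i < n ] x ≡ x ^ n
∏-const zero    x = refl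
∏-const (suc n) x = cong (x *_) (∏-const n x)

if-∏ : ∀ s k (X : Fin k → ℤ) → (if s then ∏ k X else 1ℤ) ≡ ∏[ p < k ] (if s then X p else 1ℤ)
if-∏ true  k X = refl
if-∏ false k X = sym (∏-one k)

^-distribʳ-* : ∀ x y k → (x * y) ^ k ≡ x ^ k * y ^ k
^-distribʳ-* x y zero    = refl
^-distribʳ-* x y (suc k) =
  trans (cong (_*_ (x * y)) (^-distribʳ-* x y k)) (*-interchange x y (x ^ k) (y ^ k))

∑-vecs-∏ : ∀ n (xs : List A) (f : Fin n → A → ℤ) →
           ∑[ v ∈ vecs n xs ] ∏[ i < n ] f i (lookup v i) ≡ ∏[ i < n ] ∑ xs (f i)
∑-vecs-∏ zero    xs f = refl
∑-vecs-∏ (suc n) xs f = begin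
  ∑[ v ∈ vecs (suc n) xs ] ∏[ i < suc n ] f i (lookup v i)
    ≡⟨ ∑-vecs-suc n xs _ ⟩
  ∑[ x ∈ xs ] ∑[ v ∈ vecs n xs ] f zero x * (∏[ i < n ] f (suc i) (lookup v i))
    ≡⟨ ∑-cong xs (λ x → *-distribˡ-∑ (f zero x) (vecs n xs) _) ⟨
  ∑[ x ∈ xs ] f zero x * (∑[ v ∈ vecs n xs ] ∏[ i < n ] f (suc i) (lookup v i))
    ≡⟨ ∑-cong xs (λ x → cong (f zero x *_) (∑-vecs-∏ n xs (f ∘ suc))) ⟩
  ∑[ x ∈ xs ] f zero x * (∏[ i < n ] ∑ xs (f (suc i)))
    ≡⟨ *-distribʳ-∑ _ xs (f zero) ⟨
  ∑ xs (f zero) * (∏[ i < n ] ∑ xs (f (suc i))) ∎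

∑-vecs-power : ∀ k (xs : List A) (h : A → ℤ) →
               ∑[ v ∈ vecs k xs ] ∏[ p < k ] h (lookup v p) ≡ ∑ xs h ^ k
∑-vecs-power k xs h = trans (∑-vecs-∏ k xs (λ _ → h)) (∏-const k (∑ xs h))

-- Inclusion–exclusion

-- Subsets of Fin n are characteristic vectors: sign S = (-1)^|S| and falseCount S = n - |S|.
subsets : (n : ℕ) → List (Vec Bool n)
subsets n = vecs n (true ∷ false ∷ [])

∏⟨_⟩_ : ∀ {n} → Vec Bool n → (Fin n → ℤ) → ℤ
∏⟨_⟩_ {n} S Y = ∏[ j < n ] (if lookup S j then Y j else 1ℤ)

sign : ∀ {n} → Vec Bool n → ℤ
sign S = ∏⟨ S ⟩ (λ _ → -1ℤ)

falseCount : ∀ {n} → Vec Bool n → ℕ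
falseCount []          = 0
falseCount (true  ∷ S) = falseCount S
falseCount (false ∷ S) = suc (falseCount S)

∏⟨⟩-cong : ∀ {n} (S : Vec Bool n) {Y Y′ : Fin n → ℤ} → (∀ j → Y j ≡ Y′ j) → ∏⟨ S ⟩ Y ≡ ∏⟨ S ⟩ Y′
∏⟨⟩-cong S eq = ∏-cong (λ j → cong (λ y → if lookup S j then y else 1ℤ) (eq j))

∏⟨⟩-one : ∀ {n} (S : Vec Bool n) → ∏⟨ S ⟩ (λ _ → 1ℤ) ≡ 1ℤ
∏⟨⟩-one {n} S = trans (∏-cong (λ j → if-same (lookup S j))) (∏-one n)
  where
  if-same : ∀ s → (if s then 1ℤ else 1ℤ) ≡ 1ℤ
  if-same true  = refl
  if-same false = refl

∏⟨⟩-∏ : ∀ {n k} (S : Vec Bool n) (X : Fin n → Fin k → ℤ) →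
        ∏⟨ S ⟩ (λ i → ∏[ j < k ] X i j) ≡ ∏[ i < n ] ∏[ j < k ] (if lookup S i then X i j else 1ℤ)
∏⟨⟩-∏ {k = k} S X = ∏-cong (λ i → if-∏ (lookup S i) k (X i))

∏⟨⟩-∏-comm : ∀ {n k} (S : Vec Bool n) (X : Fin n → Fin k → ℤ) →
             ∏⟨ S ⟩ (λ i → ∏[ j < k ] X i j) ≡ ∏[ j < k ] ∏⟨ S ⟩ (λ i → X i j)
∏⟨⟩-∏-comm S X = trans (∏⟨⟩-∏ S X) (∏-comm (λ i j → if lookup S i then X i j else 1ℤ))

inclusion-exclusion : ∀ n (Y : Fin n → ℤ) →
                      ∏[ j < n ] (1ℤ - Y j) ≡ ∑[ S ∈ subsets n ] sign S * ∏⟨ S ⟩ Y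
inclusion-exclusion n Y = begin
  ∏[ j < n ] (1ℤ - Y j)
    ≡⟨ ∏-cong (λ j → expand (Y j)) ⟩
  ∏[ j < n ] ∑[ b ∈ true ∷ false ∷ [] ] choice b j
    ≡⟨ ∑-vecs-∏ n (true ∷ false ∷ []) (λ j b → choice b j) ⟨
  ∑[ S ∈ subsets n ] ∏[ j < n ] choice (lookup S j) j
    ≡⟨ ∑-cong (subsets n) (λ S → trans (∏-cong (λ j → split (lookup S j) (Y j)))
                                        (∏-distrib-* (λ j → if lookup S j then -1ℤ else 1ℤ)
                                                     (λ j → if lookup S j then Y j else 1ℤ))) ⟩
  ∑[ S ∈ subsets n ] sign S * ∏⟨ S ⟩ Y ∎
  where
  choice : Bool → Fin n → ℤ
  choice b j = if b then - Y j else 1ℤ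
  expand : ∀ y → 1ℤ - y ≡ - y + (1ℤ + 0ℤ)
  expand = solve-∀
  split : ∀ b y → (if b then - y else 1ℤ) ≡ (if b then -1ℤ else 1ℤ) * (if b then y else 1ℤ)
  split true  y = sym (ℤₚ.-1*i≡-i y)
  split false y = refl

𝟙-any : ∀ {k} (p : A → Bool) (v : Vec A k) →
        𝟙 (Vec.foldr _ (λ x acc → p x ∨ acc) false v) ≡ 1ℤ - (∏[ i < k ] (1ℤ - 𝟙 (p (lookup v i))))
𝟙-any p []      = refl
𝟙-any p (x ∷ v) =
  trans (𝟙-∨ (p x) _)
        (trans (cong (λ z → 1ℤ - (1ℤ - 𝟙 (p x)) * (1ℤ - z)) (𝟙-any p v)) (cancel (𝟙 (p x)) _))
  where
  cancel : ∀ a b → 1ℤ - (1ℤ - a) * (1ℤ - (1ℤ - b)) ≡ 1ℤ - (1ℤ - a) * b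
  cancel = solve-∀

𝟙-allTrue-map : ∀ {k} (p : A → Bool) (v : Vec A k) →
                𝟙 (allTrue (Vec.map p v)) ≡ ∏[ i < k ] 𝟙 (p (lookup v i))
𝟙-allTrue-map p []      = refl
𝟙-allTrue-map p (x ∷ v) = trans (𝟙-∧ (p x) _) (cong (𝟙 (p x) *_) (𝟙-allTrue-map p v))

𝟙-all-tabulate : ∀ {b} (p : A → Bool) (f : Fin b → A) →
                 𝟙 (List.foldr (λ x acc → p x ∧ acc) true (tabulate f)) ≡ ∏[ i < b ] 𝟙 (p (f i))
𝟙-all-tabulate {b = zero}  p f = refl
𝟙-all-tabulate {b = suc b} p f =
  trans (𝟙-∧ (p (f zero)) _) (cong (𝟙 (p (f zero)) *_) (𝟙-all-tabulate p (f ∘ suc)))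

𝟙-every-some : ∀ b {k} (R : Fin b → A → Bool) (w : Fin b → Vec A k) →
  ∏[ j < b ] 𝟙 (Vec.foldr _ (λ x acc → R j x ∨ acc) false (w j))
    ≡ ∑[ S ∈ subsets b ] sign S * ∏⟨ S ⟩ (λ j → ∏[ i < k ] (1ℤ - 𝟙 (R j (lookup (w j) i))))
𝟙-every-some b R w = trans (∏-cong (λ j → 𝟙-any (R j) (w j))) (inclusion-exclusion b _)

-- Surjections

_∈ᵇ_ : ∀ {b k} → Fin b → Vec (Fin b) k → Bool
j ∈ᵇ v = Vec.foldr _ (λ i acc → ⌊ j ≟ i ⌋ ∨ acc) false v

∏⟨⟩-avoid : ∀ {n} (S : Vec Bool n) (x : Fin n) →
            ∏⟨ S ⟩ (λ j → 1ℤ - 𝟙 ⌊ j ≟ x ⌋) ≡ 𝟙 (not (lookup S x))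
∏⟨⟩-avoid (s ∷ S) zero    = trans (cong ((if s then 0ℤ else 1ℤ) *_) (∏⟨⟩-one S)) (at-x s)
  where
  at-x : ∀ s → (if s then 0ℤ else 1ℤ) * 1ℤ ≡ 𝟙 (not s)
  at-x true  = refl
  at-x false = refl
∏⟨⟩-avoid (s ∷ S) (suc x) = begin
  (if s then 1ℤ else 1ℤ) * ∏⟨ S ⟩ (λ j → 1ℤ - 𝟙 ⌊ suc j ≟ suc x ⌋)
    ≡⟨ cong₂ _*_ (off-x s) (∏⟨⟩-cong S (λ j → cong (λ b → 1ℤ - 𝟙 b) (⌊⌋-map′ _ _ (j ≟ x)))) ⟩
  1ℤ * ∏⟨ S ⟩ (λ j → 1ℤ - 𝟙 ⌊ j ≟ x ⌋)
    ≡⟨ ℤₚ.*-identityˡ _ ⟩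
  ∏⟨ S ⟩ (λ j → 1ℤ - 𝟙 ⌊ j ≟ x ⌋)
    ≡⟨ ∏⟨⟩-avoid S x ⟩
  𝟙 (not (lookup S x)) ∎
  where
  off-x : ∀ s → (if s then 1ℤ else 1ℤ) ≡ 1ℤ
  off-x true  = refl
  off-x false = refl

𝟙-isSurj : ∀ {k b} (v : Vec (Fin b) k) →
           𝟙 (isSurj v) ≡ ∑[ S ∈ subsets b ] sign S * (∏[ p < k ] 𝟙 (not (lookup S (lookup v p))))
𝟙-isSurj {k} {b} v = begin
  𝟙 (isSurj v)
    ≡⟨ 𝟙-all-tabulate (_∈ᵇ v) (λ j → j) ⟩
  ∏[ j < b ] 𝟙 (j ∈ᵇ v)
    ≡⟨ 𝟙-every-some b (λ j i → ⌊ j ≟ i ⌋) (λ _ → v) ⟩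
  ∑[ S ∈ subsets b ] sign S * ∏⟨ S ⟩ (λ j → ∏[ p < k ] miss j p)
    ≡⟨ ∑-cong (subsets b) (λ S → cong (sign S *_) (trans (∏⟨⟩-∏-comm S miss)
                                                        (∏-cong (λ p → ∏⟨⟩-avoid S (lookup v p))))) ⟩
  ∑[ S ∈ subsets b ] sign S * (∏[ p < k ] 𝟙 (not (lookup S (lookup v p)))) ∎
  where
  miss : Fin b → Fin k → ℤ
  miss j p = 1ℤ - 𝟙 ⌊ j ≟ lookup v p ⌋

∑-allFin-𝟙-not : ∀ {n} (S : Vec Bool n) → ∑[ x ∈ allFin n ] 𝟙 (not (lookup S x)) ≡ + falseCount S
∑-allFin-𝟙-not []              = refl
∑-allFin-𝟙-not {suc n} (s ∷ S) =
  trans (cong (_+_ (𝟙 (not s))) (trans (∑-tabulate n suc _) (∑-allFin-𝟙-not S))) (head s)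
  where
  head : ∀ s → 𝟙 (not s) + + falseCount S ≡ + falseCount (s ∷ S)
  head true  = ℤₚ.+-identityˡ _
  head false = refl

ballotCount-inclusion-exclusion : ∀ k b →
  + ballotCount k b ≡ ∑[ S ∈ subsets b ] sign S * (+ falseCount S) ^ k
ballotCount-inclusion-exclusion k b = begin
  + ballotCount k b
    ≡⟨ length-filterᵇ isSurj maps ⟩
  ∑[ v ∈ maps ] 𝟙 (isSurj v)
    ≡⟨ ∑-cong maps 𝟙-isSurj ⟩
  ∑[ v ∈ maps ] ∑[ S ∈ subsets b ] sign S * (∏[ p < k ] outside S v p)
    ≡⟨ ∑-comm maps (subsets b) _ ⟩
  ∑[ S ∈ subsets b ] ∑[ v ∈ maps ] sign S * (∏[ p < k ] outside S v p)
    ≡⟨ ∑-cong (subsets b) (λ S → *-distribˡ-∑ (sign S) maps _) ⟨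
  ∑[ S ∈ subsets b ] sign S * (∑[ v ∈ maps ] ∏[ p < k ] outside S v p)
    ≡⟨ ∑-cong (subsets b) (λ S → cong (sign S *_) (trans (∑-vecs-power k (allFin b) _)
                                                        (cong (_^ k) (∑-allFin-𝟙-not S)))) ⟩
  ∑[ S ∈ subsets b ] sign S * (+ falseCount S) ^ k ∎
  where
  maps = vecs k (allFin b)
  outside : Vec Bool b → Vec (Fin b) k → Fin k → ℤ
  outside S v p = 𝟙 (not (lookup S (lookup v p)))

ballotCount-product : ∀ k r c →
  + ballotCount k r * + ballotCount k c
    ≡ ∑[ S ∈ subsets r ] ∑[ T ∈ subsets c ] sign S * sign T * (+ (falseCount S ℕ.* falseCount T)) ^ k
ballotCount-product k r c = begin
  + ballotCount k r * + ballotCount k c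
    ≡⟨ cong₂ _*_ (ballotCount-inclusion-exclusion k r) (ballotCount-inclusion-exclusion k c) ⟩
  (∑[ S ∈ subsets r ] sign S * (+ falseCount S) ^ k) * (∑[ T ∈ subsets c ] sign T * (+ falseCount T) ^ k)
    ≡⟨ ∑-product (subsets r) (subsets c) _ _ ⟩
  ∑[ S ∈ subsets r ] ∑[ T ∈ subsets c ] sign S * (+ falseCount S) ^ k * (sign T * (+ falseCount T) ^ k)
    ≡⟨ ∑-cong (subsets r) (λ S → ∑-cong (subsets c) (λ T → combine S T)) ⟩
  ∑[ S ∈ subsets r ] ∑[ T ∈ subsets c ] sign S * sign T * (+ (falseCount S ℕ.* falseCount T)) ^ k ∎
  where
  combine : ∀ S T → sign S * (+ falseCount S) ^ k * (sign T * (+ falseCount T) ^ k)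
                  ≡ sign S * sign T * (+ (falseCount S ℕ.* falseCount T)) ^ k
  combine S T = begin
    sign S * (+ falseCount S) ^ k * (sign T * (+ falseCount T) ^ k)
      ≡⟨ *-interchange (sign S) _ (sign T) _ ⟩
    sign S * sign T * ((+ falseCount S) ^ k * (+ falseCount T) ^ k)
      ≡⟨ cong (sign S * sign T *_) (^-distribʳ-* (+ falseCount S) (+ falseCount T) k) ⟨
    sign S * sign T * (+ falseCount S * + falseCount T) ^ k
      ≡⟨ cong (λ x → sign S * sign T * x ^ k) (ℤₚ.pos-* (falseCount S) (falseCount T)) ⟨
    sign S * sign T * (+ (falseCount S ℕ.* falseCount T)) ^ k ∎

T-all-tabulate : ∀ {b} (p : A → Bool) (f : Fin b → A) →
                 T (List.foldr (λ x acc → p x ∧ acc) true (tabulate f)) → ∀ i → T (p (f i))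
T-all-tabulate p f t zero    = proj₁ (Equivalence.to T-∧ t)
T-all-tabulate p f t (suc i) = T-all-tabulate p (f ∘ suc) (proj₂ (Equivalence.to T-∧ t)) i

∈ᵇ⇒preimage : ∀ {b k} (j : Fin b) (v : Vec (Fin b) k) → T (j ∈ᵇ v) → ∃ λ p → lookup v p ≡ j
∈ᵇ⇒preimage j (x ∷ v) t with j ≟ x
... | yes j≡x = zero , sym j≡x
... | no  _   = let p , vp≡j = ∈ᵇ⇒preimage j v t in suc p , vp≡j

isSurj⇒≤ : ∀ {k b} (v : Vec (Fin b) k) → T (isSurj v) → b ≤ k
isSurj⇒≤ {k} {b} v surj = injective⇒≤ {f = section} section-injective
  where
  preimage : ∀ j → ∃ λ p → lookup v p ≡ j
  preimage j = ∈ᵇ⇒preimage j v (T-all-tabulate (_∈ᵇ v) (λ j → j) surj j)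
  section : Fin b → Fin k
  section j = proj₁ (preimage j)
  section-injective : ∀ {i j} → section i ≡ section j → i ≡ j
  section-injective {i} {j} eq =
    trans (sym (proj₂ (preimage i))) (trans (cong (lookup v) eq) (proj₂ (preimage j)))

ballotCount-vanishes : ∀ {k b} → k < b → + ballotCount k b ≡ 0ℤ
ballotCount-vanishes {k} {b} k<b = begin
  + ballotCount k b              ≡⟨ length-filterᵇ isSurj maps ⟩
  ∑[ v ∈ maps ] 𝟙 (isSurj v)     ≡⟨ ∑-cong maps not-surj ⟩
  ∑[ v ∈ maps ] 0ℤ               ≡⟨ ∑-zero maps ⟩
  0ℤ                             ∎
  where
  maps = vecs k (allFin b)
  not-surj : ∀ v → 𝟙 (isSurj v) ≡ 0ℤ
  not-surj v with isSurj v in eq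
  ... | true  = contradiction (isSurj⇒≤ v (Equivalence.from T-≡ eq)) (ℕₚ.<⇒≱ k<b)
  ... | false = refl

Bal-extend : ∀ {k n} (x : ℤ) → k ≤ n → Bal k x ≡ Σ≤ n (λ b → + ballotCount k b * x ^ b)
Bal-extend x k≤n = Σ≤-extend _ k≤n (λ b k<b →
  trans (cong (_* x ^ b) (ballotCount-vanishes k<b)) (ℤₚ.*-zeroˡ (x ^ b)))

-- Counting 0/1 matrices with prescribed zeros

-- binomialShift a g = (1 + E)ᵃ g for the shift E g = g ∘ suc; at 0 it is Σₖ C(a, k) g k.
binomialShift : ℕ → (ℕ → ℤ) → ℕ → ℤ
binomialShift zero    g e = g e
binomialShift (suc a) g e = binomialShift a g (suc e) + binomialShift a g e

binomialShift-+ : ∀ a b g e → binomialShift a (binomialShift b g) e ≡ binomialShift (a ℕ.+ b) g e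
binomialShift-+ zero    b g e = refl
binomialShift-+ (suc a) b g e =
  cong₂ _+_ (binomialShift-+ a b g (suc e)) (binomialShift-+ a b g e)

δ : ℕ → ℕ → ℤ
δ n k = 𝟙 ⌊ k ℕ.≟ n ⌋

δ-≢ : ∀ {n k} → k ≢ n → δ n k ≡ 0ℤ
δ-≢ {n} {k} k≢n = cong 𝟙 (trans (isYes≗does (k ℕ.≟ n)) (dec-false (k ℕ.≟ n) k≢n))

δ-refl : ∀ n → δ n n ≡ 1ℤ
δ-refl n = cong 𝟙 (trans (isYes≗does (n ℕ.≟ n)) (dec-true (n ℕ.≟ n) refl))

binomialShift-δ-beyond : ∀ a {n e} → n < e → binomialShift a (δ n) e ≡ 0ℤ
binomialShift-δ-beyond zero    n<e = δ-≢ (ℕₚ.>⇒≢ n<e)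
binomialShift-δ-beyond (suc a) n<e =
  cong₂ _+_ (binomialShift-δ-beyond a (ℕₚ.m<n⇒m<1+n n<e)) (binomialShift-δ-beyond a n<e)

binomialShift-δ-offset : ∀ a k e → binomialShift a (δ (k ℕ.+ e)) e ≡ + (a C k)
binomialShift-δ-offset zero    zero    e = δ-refl e
binomialShift-δ-offset zero    (suc k) e = δ-≢ (ℕₚ.<⇒≢ (s≤s (ℕₚ.m≤n+m e k)))
binomialShift-δ-offset (suc a) zero    e =
  cong₂ _+_ (binomialShift-δ-beyond a (ℕₚ.n<1+n e)) (binomialShift-δ-offset a zero e)
binomialShift-δ-offset (suc a) (suc k) e = begin
  binomialShift a (δ (suc k ℕ.+ e)) (suc e) + binomialShift a (δ (suc k ℕ.+ e)) e
    ≡⟨ cong₂ _+_ (cong (λ n → binomialShift a (δ n) (suc e)) (ℕₚ.+-suc k e)) refl ⟨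
  binomialShift a (δ (k ℕ.+ suc e)) (suc e) + binomialShift a (δ (suc k ℕ.+ e)) e
    ≡⟨ cong₂ _+_ (binomialShift-δ-offset a k (suc e)) (binomialShift-δ-offset a (suc k) e) ⟩
  + (a C k) + + (a C suc k)
    ≡⟨ ℤₚ.pos-+ (a C k) (a C suc k) ⟨
  + (a C k ℕ.+ a C suc k)
    ≡⟨ cong +_ (nCk+nC[k+1]≡[n+1]C[k+1] a k) ⟩
  + (suc a C suc k) ∎

binomialShift-δ : ∀ a n → binomialShift a (δ n) 0 ≡ + (a C n)
binomialShift-δ a n =
  trans (cong (λ n′ → binomialShift a (δ n′) 0) (sym (ℕₚ.+-identityʳ n))) (binomialShift-δ-offset a n 0)

vanishesOn : ∀ {c} → Vec Bool c → Vec Bool c → ℤ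
vanishesOn a v = ∏⟨ a ⟩ (λ j → 1ℤ - 𝟙 (lookup v j))

vanishesOnᴹ : ∀ {r c} → Matrix01 r c → Matrix01 r c → ℤ
vanishesOnᴹ {r} M m = ∏[ i < r ] vanishesOn (lookup M i) (lookup m i)

falseCountᴹ : ∀ {r c} → Matrix01 r c → ℕ
falseCountᴹ []      = 0
falseCountᴹ (a ∷ M) = falseCount a ℕ.+ falseCountᴹ M

∑-subsets-suc : ∀ c (f : Vec Bool (suc c) → ℤ) →
  ∑ (subsets (suc c)) f ≡ (∑[ v ∈ subsets c ] f (true ∷ v)) + (∑[ v ∈ subsets c ] f (false ∷ v))
∑-subsets-suc c f =
  trans (∑-vecs-suc c _ f) (cong (_+_ (∑ (subsets c) (f ∘ (true ∷_)))) (ℤₚ.+-identityʳ _))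

∑-vanishesOn : ∀ {c} (a : Vec Bool c) (g : ℕ → ℤ) e →
  ∑[ v ∈ subsets c ] vanishesOn a v * g (e ℕ.+ countOnes v) ≡ binomialShift (falseCount a) g e
∑-vanishesOn []      g e =
  trans (ℤₚ.+-identityʳ _) (trans (ℤₚ.*-identityˡ _) (cong g (ℕₚ.+-identityʳ e)))
∑-vanishesOn {suc c} (true ∷ a) g e = begin
  ∑[ v ∈ subsets (suc c) ] vanishesOn (true ∷ a) v * g (e ℕ.+ countOnes v)
    ≡⟨ ∑-subsets-suc c _ ⟩
  (∑[ v ∈ subsets c ] 0ℤ * vanishesOn a v * g (e ℕ.+ suc (countOnes v)))
    + (∑[ v ∈ subsets c ] 1ℤ * vanishesOn a v * g (e ℕ.+ countOnes v))
    ≡⟨ cong₂ _+_ (trans (∑-cong (subsets c) (λ v → ℤₚ.*-zeroˡ (g (e ℕ.+ suc (countOnes v)))))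
                        (∑-zero (subsets c)))
                 (∑-cong (subsets c) (λ v → cong (_* g (e ℕ.+ countOnes v))
                                                 (ℤₚ.*-identityˡ (vanishesOn a v)))) ⟩
  0ℤ + (∑[ v ∈ subsets c ] vanishesOn a v * g (e ℕ.+ countOnes v))
    ≡⟨ trans (ℤₚ.+-identityˡ _) (∑-vanishesOn a g e) ⟩
  binomialShift (falseCount a) g e ∎
∑-vanishesOn {suc c} (false ∷ a) g e = begin
  ∑[ v ∈ subsets (suc c) ] vanishesOn (false ∷ a) v * g (e ℕ.+ countOnes v)
    ≡⟨ ∑-subsets-suc c _ ⟩
  (∑[ v ∈ subsets c ] 1ℤ * vanishesOn a v * g (e ℕ.+ suc (countOnes v)))
    + (∑[ v ∈ subsets c ] 1ℤ * vanishesOn a v * g (e ℕ.+ countOnes v))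
    ≡⟨ cong₂ _+_ (∑-cong (subsets c) (λ v → cong₂ _*_ (ℤₚ.*-identityˡ (vanishesOn a v))
                                                     (cong g (ℕₚ.+-suc e (countOnes v)))))
                 (∑-cong (subsets c) (λ v → cong (_* g (e ℕ.+ countOnes v))
                                                 (ℤₚ.*-identityˡ (vanishesOn a v)))) ⟩
  (∑[ v ∈ subsets c ] vanishesOn a v * g (suc e ℕ.+ countOnes v))
    + (∑[ v ∈ subsets c ] vanishesOn a v * g (e ℕ.+ countOnes v))
    ≡⟨ cong₂ _+_ (∑-vanishesOn a g (suc e)) (∑-vanishesOn a g e) ⟩
  binomialShift (suc (falseCount a)) g e ∎

∑-vanishesOnᴹ : ∀ {r c} (M : Matrix01 r c) (g : ℕ → ℤ) e →
  ∑[ m ∈ allMatrices r c ] vanishesOnᴹ M m * g (e ℕ.+ size m) ≡ binomialShift (falseCountᴹ M) g e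
∑-vanishesOnᴹ []      g e =
  trans (ℤₚ.+-identityʳ _) (trans (ℤₚ.*-identityˡ _) (cong g (ℕₚ.+-identityʳ e)))
∑-vanishesOnᴹ {suc r} {c} (a ∷ M) g e = begin
  ∑[ m ∈ allMatrices (suc r) c ] vanishesOnᴹ (a ∷ M) m * g (e ℕ.+ size m)
    ≡⟨ ∑-vecs-suc r (subsets c) _ ⟩
  ∑[ v ∈ subsets c ] ∑[ m ∈ matrices ] vanishesOn a v * vanishesOnᴹ M m * g (e ℕ.+ (countOnes v ℕ.+ size m))
    ≡⟨ ∑-cong (subsets c) (λ v → ∑-cong matrices (λ m → regroup v m)) ⟩
  ∑[ v ∈ subsets c ] ∑[ m ∈ matrices ] vanishesOn a v * (vanishesOnᴹ M m * g (e ℕ.+ countOnes v ℕ.+ size m))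
    ≡⟨ ∑-cong (subsets c) (λ v → *-distribˡ-∑ (vanishesOn a v) matrices _) ⟨
  ∑[ v ∈ subsets c ] vanishesOn a v * (∑[ m ∈ matrices ] vanishesOnᴹ M m * g (e ℕ.+ countOnes v ℕ.+ size m))
    ≡⟨ ∑-cong (subsets c) (λ v → cong (vanishesOn a v *_) (∑-vanishesOnᴹ M g (e ℕ.+ countOnes v))) ⟩
  ∑[ v ∈ subsets c ] vanishesOn a v * binomialShift (falseCountᴹ M) g (e ℕ.+ countOnes v)
    ≡⟨ ∑-vanishesOn a (binomialShift (falseCountᴹ M) g) e ⟩
  binomialShift (falseCount a) (binomialShift (falseCountᴹ M) g) e
    ≡⟨ binomialShift-+ (falseCount a) (falseCountᴹ M) g e ⟩
  binomialShift (falseCountᴹ (a ∷ M)) g e ∎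
  where
  matrices = allMatrices r c
  regroup : ∀ v m → vanishesOn a v * vanishesOnᴹ M m * g (e ℕ.+ (countOnes v ℕ.+ size m))
                  ≡ vanishesOn a v * (vanishesOnᴹ M m * g (e ℕ.+ countOnes v ℕ.+ size m))
  regroup v m =
    trans (ℤₚ.*-assoc (vanishesOn a v) (vanishesOnᴹ M m) _)
          (cong (λ k → vanishesOn a v * (vanishesOnᴹ M m * g k)) (sym (ℕₚ.+-assoc e (countOnes v) (size m))))

-- Binary Burge matrices

lookup-transpose-∷ : ∀ {r c} (row : Vec A c) (m : Vec (Vec A c) r) j →
                     lookup (Vec.transpose (row ∷ m)) j ≡ lookup row j ∷ lookup (Vec.transpose m) j
lookup-transpose-∷ {c = c} row m j = begin
  lookup (conses Vec.⊛ row Vec.⊛ Vec.transpose m) j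
    ≡⟨ Vecₚ.lookup-⊛ j (conses Vec.⊛ row) (Vec.transpose m) ⟩
  lookup (conses Vec.⊛ row) j (lookup (Vec.transpose m) j)
    ≡⟨ cong (λ f → f (lookup (Vec.transpose m) j)) (Vecₚ.lookup-⊛ j conses row) ⟩
  lookup conses j (lookup row j) (lookup (Vec.transpose m) j)
    ≡⟨ cong (λ f → f (lookup row j) (lookup (Vec.transpose m) j)) (Vecₚ.lookup-replicate j Vec._∷_) ⟩
  lookup row j ∷ lookup (Vec.transpose m) j ∎
  where
  conses = Vec.replicate c Vec._∷_

lookup-transpose : ∀ {r c} (m : Vec (Vec A c) r) i j →
                   lookup (lookup (Vec.transpose m) j) i ≡ lookup (lookup m i) j
lookup-transpose (row ∷ m) i j =
  trans (cong (λ column → lookup column i) (lookup-transpose-∷ row m j)) (entry i)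

  where
  entry : ∀ i → lookup (lookup row j ∷ lookup (Vec.transpose m) j) i ≡ lookup (lookup (row ∷ m) i) j
  entry zero    = refl
  entry (suc i) = lookup-transpose m i j

𝟙-allRowsNonzero : ∀ {r c} (m : Matrix01 r c) →
  𝟙 (allTrue (Vec.map anyTrue m))
    ≡ ∑[ S ∈ subsets r ] sign S * ∏⟨ S ⟩ (λ i → ∏[ j < c ] (1ℤ - 𝟙 (lookup (lookup m i) j)))
𝟙-allRowsNonzero {r} m =
  trans (𝟙-allTrue-map anyTrue m) (𝟙-every-some r (λ _ x → x) (lookup m))

rowsOrColumns : ∀ {r c} → Vec Bool r → Vec Bool c → Matrix01 r c
rowsOrColumns S T = Vec.map (λ s → Vec.map (s ∨_) T) S

lookup-rowsOrColumns : ∀ {r c} (S : Vec Bool r) (T : Vec Bool c) i j →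
                       lookup (lookup (rowsOrColumns S T) i) j ≡ lookup S i ∨ lookup T j
lookup-rowsOrColumns S T i j =
  trans (cong (λ row → lookup row j) (Vecₚ.lookup-map i _ S)) (Vecₚ.lookup-map j _ T)

falseCount-all-true : ∀ {c} (T : Vec Bool c) → falseCount (Vec.map (λ _ → true) T) ≡ 0
falseCount-all-true []      = refl
falseCount-all-true (t ∷ T) = falseCount-all-true T

falseCountᴹ-rowsOrColumns : ∀ {r c} (S : Vec Bool r) (T : Vec Bool c) →
                            falseCountᴹ (rowsOrColumns S T) ≡ falseCount S ℕ.* falseCount T
falseCountᴹ-rowsOrColumns []          T = refl
falseCountᴹ-rowsOrColumns (true  ∷ S) T =
  cong₂ ℕ._+_ (falseCount-all-true T) (falseCountᴹ-rowsOrColumns S T)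
falseCountᴹ-rowsOrColumns (false ∷ S) T =
  cong₂ ℕ._+_ (cong falseCount (Vecₚ.map-id T)) (falseCountᴹ-rowsOrColumns S T)

if-∨ : ∀ {z} → z * z ≡ z → ∀ s t →
       (if s then z else 1ℤ) * (if t then z else 1ℤ) ≡ (if s ∨ t then z else 1ℤ)
if-∨ z*z≡z true  true  = z*z≡z
if-∨ z*z≡z true  false = ℤₚ.*-identityʳ _
if-∨ z*z≡z false true  = ℤₚ.*-identityˡ _
if-∨ z*z≡z false false = refl

1-𝟙-idem : ∀ b → (1ℤ - 𝟙 b) * (1ℤ - 𝟙 b) ≡ 1ℤ - 𝟙 b
1-𝟙-idem true  = refl
1-𝟙-idem false = refl

∏⟨⟩-rows-∏⟨⟩-columns : ∀ {r c} (S : Vec Bool r) (T : Vec Bool c) (m : Matrix01 r c) →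
  let Z = λ i j → 1ℤ - 𝟙 (lookup (lookup m i) j) in
  ∏⟨ S ⟩ (λ i → ∏[ j < c ] Z i j) * ∏⟨ T ⟩ (λ j → ∏[ i < r ] Z i j) ≡ vanishesOnᴹ (rowsOrColumns S T) m
∏⟨⟩-rows-∏⟨⟩-columns {r} {c} S T m = begin
  ∏⟨ S ⟩ (λ i → ∏[ j < c ] Z i j) * ∏⟨ T ⟩ (λ j → ∏[ i < r ] Z i j)
    ≡⟨ cong₂ _*_ (∏⟨⟩-∏ S Z) (∏⟨⟩-∏-comm T (λ j i → Z i j)) ⟩
  (∏[ i < r ] ∏[ j < c ] inRow i j) * (∏[ i < r ] ∏[ j < c ] inColumn i j)
    ≡⟨ ∏-distrib-* (λ i → ∏[ j < c ] inRow i j) (λ i → ∏[ j < c ] inColumn i j) ⟨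
  ∏[ i < r ] (∏[ j < c ] inRow i j) * (∏[ j < c ] inColumn i j)
    ≡⟨ ∏-cong (λ i → ∏-distrib-* (inRow i) (inColumn i)) ⟨
  ∏[ i < r ] ∏[ j < c ] inRow i j * inColumn i j
    ≡⟨ ∏-cong (λ i → ∏-cong (λ j → if-∨ (1-𝟙-idem (lookup (lookup m i) j)) (lookup S i) (lookup T j))) ⟩
  ∏[ i < r ] ∏[ j < c ] (if lookup S i ∨ lookup T j then Z i j else 1ℤ)
    ≡⟨ ∏-cong (λ i → ∏-cong (λ j → cong (λ b → if b then Z i j else 1ℤ) (lookup-rowsOrColumns S T i j))) ⟨
  vanishesOnᴹ (rowsOrColumns S T) m ∎
  where
  Z inRow inColumn : Fin r → Fin c → ℤ
  Z i j        = 1ℤ - 𝟙 (lookup (lookup m i) j)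
  inRow i j    = if lookup S i then Z i j else 1ℤ
  inColumn i j = if lookup T j then Z i j else 1ℤ

𝟙-isBurgeOfSize : ∀ {r c} n (m : Matrix01 r c) →
  𝟙 (isBurgeOfSize n m)
    ≡ ∑[ S ∈ subsets r ] ∑[ T ∈ subsets c ] sign S * sign T * (vanishesOnᴹ (rowsOrColumns S T) m * δ n (size m))
𝟙-isBurgeOfSize {r} {c} n m = begin
  𝟙 (rowsNonzero ∧ columnsNonzero ∧ ⌊ size m ℕ.≟ n ⌋)
    ≡⟨ trans (𝟙-∧ rowsNonzero _) (cong (𝟙 rowsNonzero *_) (𝟙-∧ columnsNonzero _)) ⟩
  𝟙 rowsNonzero * (𝟙 columnsNonzero * d)
    ≡⟨ cong₂ (λ x y → x * (y * d)) (𝟙-allRowsNonzero m) 𝟙-columnsNonzero ⟩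
  (∑[ S ∈ subsets r ] sign S * R S) * ((∑[ T ∈ subsets c ] sign T * C T) * d)
    ≡⟨ cong (_*_ (∑[ S ∈ subsets r ] sign S * R S)) (*-distribʳ-∑ d (subsets c) (λ T → sign T * C T)) ⟩
  (∑[ S ∈ subsets r ] sign S * R S) * (∑[ T ∈ subsets c ] sign T * C T * d)
    ≡⟨ ∑-product (subsets r) (subsets c) (λ S → sign S * R S) (λ T → sign T * C T * d) ⟩
  ∑[ S ∈ subsets r ] ∑[ T ∈ subsets c ] sign S * R S * (sign T * C T * d)
    ≡⟨ ∑-cong (subsets r) (λ S → ∑-cong (subsets c) (λ T →
         trans (regroup (sign S) (sign T) (R S) (C T) d)
               (cong (λ x → sign S * sign T * (x * d)) (∏⟨⟩-rows-∏⟨⟩-columns S T m)))) ⟩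
  ∑[ S ∈ subsets r ] ∑[ T ∈ subsets c ] sign S * sign T * (vanishesOnᴹ (rowsOrColumns S T) m * d) ∎
  where
  rowsNonzero    = allTrue (Vec.map anyTrue m)
  columnsNonzero = allTrue (Vec.map anyTrue (Vec.transpose m))
  d = δ n (size m)
  Z : Fin r → Fin c → ℤ
  Z i j = 1ℤ - 𝟙 (lookup (lookup m i) j)
  R : Vec Bool r → ℤ
  R S = ∏⟨ S ⟩ (λ i → ∏[ j < c ] Z i j)
  C : Vec Bool c → ℤ
  C T = ∏⟨ T ⟩ (λ j → ∏[ i < r ] Z i j)
  𝟙-columnsNonzero : 𝟙 columnsNonzero ≡ ∑[ T ∈ subsets c ] sign T * C T
  𝟙-columnsNonzero =
    trans (𝟙-allRowsNonzero (Vec.transpose m))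
          (∑-cong (subsets c) (λ T → cong (sign T *_) (∏⟨⟩-cong T (λ j → ∏-cong (λ i →
            cong (λ b → 1ℤ - 𝟙 b) (lookup-transpose m i j))))))
  regroup : ∀ s t x y z → s * x * (t * y * z) ≡ s * t * (x * y * z)
  regroup = solve-∀

burgeCount-inclusion-exclusion : ∀ n r c →
  + burgeCount n r c
    ≡ ∑[ S ∈ subsets r ] ∑[ T ∈ subsets c ] sign S * sign T * + ((falseCount S ℕ.* falseCount T) C n)
burgeCount-inclusion-exclusion n r c = begin
  + burgeCount n r c
    ≡⟨ length-filterᵇ (isBurgeOfSize n) matrices ⟩
  ∑[ m ∈ matrices ] 𝟙 (isBurgeOfSize n m)
    ≡⟨ ∑-cong matrices (𝟙-isBurgeOfSize n) ⟩
  ∑[ m ∈ matrices ] ∑[ S ∈ subsets r ] ∑[ T ∈ subsets c ] sign S * sign T * W S T m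
    ≡⟨ ∑-comm matrices (subsets r) _ ⟩
  ∑[ S ∈ subsets r ] ∑[ m ∈ matrices ] ∑[ T ∈ subsets c ] sign S * sign T * W S T m
    ≡⟨ ∑-cong (subsets r) (λ S → ∑-comm matrices (subsets c) _) ⟩
  ∑[ S ∈ subsets r ] ∑[ T ∈ subsets c ] ∑[ m ∈ matrices ] sign S * sign T * W S T m
    ≡⟨ ∑-cong (subsets r) (λ S → ∑-cong (subsets c) (λ T → *-distribˡ-∑ (sign S * sign T) matrices (W S T))) ⟨
  ∑[ S ∈ subsets r ] ∑[ T ∈ subsets c ] sign S * sign T * (∑[ m ∈ matrices ] W S T m)
    ≡⟨ ∑-cong (subsets r) (λ S → ∑-cong (subsets c) (λ T → cong (sign S * sign T *_) (count S T))) ⟩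
  ∑[ S ∈ subsets r ] ∑[ T ∈ subsets c ] sign S * sign T * + ((falseCount S ℕ.* falseCount T) C n) ∎
  where
  matrices = allMatrices r c
  W : Vec Bool r → Vec Bool c → Matrix01 r c → ℤ
  W S T m = vanishesOnᴹ (rowsOrColumns S T) m * δ n (size m)
  count : ∀ S T → ∑[ m ∈ matrices ] W S T m ≡ + ((falseCount S ℕ.* falseCount T) C n)
  count S T = begin
    ∑[ m ∈ matrices ] W S T m                  ≡⟨ ∑-vanishesOnᴹ M (δ n) 0 ⟩
    binomialShift (falseCountᴹ M) (δ n) 0      ≡⟨ binomialShift-δ (falseCountᴹ M) n ⟩
    + (falseCountᴹ M C n)                      ≡⟨ cong (λ a → + (a C n)) (falseCountᴹ-rowsOrColumns S T) ⟩
    + ((falseCount S ℕ.* falseCount T) C n)    ∎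
    where
    M = rowsOrColumns S T

-- Stirling numbers and falling factorials

[k+1]*mC[k+1]+k*mCk≡m*mCk : ∀ m k → suc k ℕ.* (m C suc k) ℕ.+ k ℕ.* (m C k) ≡ m ℕ.* (m C k)
[k+1]*mC[k+1]+k*mCk≡m*mCk zero    zero    = refl
[k+1]*mC[k+1]+k*mCk≡m*mCk zero    (suc k) = cong₂ ℕ._+_ (ℕₚ.*-zeroʳ (suc (suc k))) (ℕₚ.*-zeroʳ (suc k))
[k+1]*mC[k+1]+k*mCk≡m*mCk (suc m) zero    = begin
  1 ℕ.* (suc m C 1) ℕ.+ 0  ≡⟨ trans (ℕₚ.+-identityʳ _) (ℕₚ.*-identityˡ _) ⟩
  suc m C 1                ≡⟨ nC1≡n (suc m) ⟩
  suc m                    ≡⟨ ℕₚ.*-identityʳ (suc m) ⟨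
  suc m ℕ.* 1              ∎
[k+1]*mC[k+1]+k*mCk≡m*mCk (suc m) (suc k) = begin
  suc (suc k) ℕ.* (suc m C suc (suc k)) ℕ.+ suc k ℕ.* (suc m C suc k)
    ≡⟨ cong₂ (λ x y → suc (suc k) ℕ.* x ℕ.+ suc k ℕ.* y)
             (nCk+nC[k+1]≡[n+1]C[k+1] m (suc k)) (nCk+nC[k+1]≡[n+1]C[k+1] m k) ⟨
  suc (suc k) ℕ.* (b ℕ.+ c) ℕ.+ suc k ℕ.* (a ℕ.+ b)
    ≡⟨ split k a b c ⟩
  (suc (suc k) ℕ.* c ℕ.+ suc k ℕ.* b) ℕ.+ (suc k ℕ.* b ℕ.+ k ℕ.* a) ℕ.+ b ℕ.+ a
    ≡⟨ cong₂ (λ x y → x ℕ.+ y ℕ.+ b ℕ.+ a)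
             ([k+1]*mC[k+1]+k*mCk≡m*mCk m (suc k)) ([k+1]*mC[k+1]+k*mCk≡m*mCk m k) ⟩
  m ℕ.* b ℕ.+ m ℕ.* a ℕ.+ b ℕ.+ a
    ≡⟨ collect m a b ⟩
  suc m ℕ.* (a ℕ.+ b)
    ≡⟨ cong (suc m ℕ.*_) (nCk+nC[k+1]≡[n+1]C[k+1] m k) ⟩
  suc m ℕ.* (suc m C suc k) ∎
  where
  a = m C k
  b = m C suc k
  c = m C suc (suc k)
  split : ∀ k a b c →
          suc (suc k) ℕ.* (b ℕ.+ c) ℕ.+ suc k ℕ.* (a ℕ.+ b)
            ≡ (suc (suc k) ℕ.* c ℕ.+ suc k ℕ.* b) ℕ.+ (suc k ℕ.* b ℕ.+ k ℕ.* a) ℕ.+ b ℕ.+ a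
  split = ℕ-solve-∀
  collect : ∀ m a b → m ℕ.* b ℕ.+ m ℕ.* a ℕ.+ b ℕ.+ a ≡ suc m ℕ.* (a ℕ.+ b)
  collect = ℕ-solve-∀

falling : ℤ → ℕ → ℤ
falling x zero    = 1ℤ
falling x (suc n) = (x - + n) * falling x n

falling-binomial : ∀ m n → falling (+ m) n ≡ + (n ! ℕ.* (m C n))
falling-binomial m zero    = refl
falling-binomial m (suc n) = begin
  (+ m - + n) * falling (+ m) n
    ≡⟨ cong ((+ m - + n) *_) (trans (falling-binomial m n) (ℤₚ.pos-* (n !) c)) ⟩
  (+ m - + n) * (+ (n !) * + c)
    ≡⟨ expand (+ m) (+ n) (+ (n !)) (+ c) ⟩
  + (n !) * (+ m * + c) - + (n !) * (+ n * + c)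
    ≡⟨ cong (λ z → + (n !) * z - + (n !) * (+ n * + c)) absorption ⟩
  + (n !) * (+ suc n * + d + + n * + c) - + (n !) * (+ n * + c)
    ≡⟨ cancel (+ (n !)) (+ suc n) (+ d) (+ n * + c) ⟩
  + suc n * + (n !) * + d
    ≡⟨ trans (ℤₚ.pos-* (suc n ℕ.* n !) d) (cong (_* + d) (ℤₚ.pos-* (suc n) (n !))) ⟨
  + (suc n ! ℕ.* d) ∎
  where
  c = m C n
  d = m C suc n
  absorption : + m * + c ≡ + suc n * + d + + n * + c
  absorption = begin
    + m * + c                      ≡⟨ ℤₚ.pos-* m c ⟨
    + (m ℕ.* c)                    ≡⟨ cong +_ ([k+1]*mC[k+1]+k*mCk≡m*mCk m n) ⟨
    + (suc n ℕ.* d ℕ.+ n ℕ.* c)    ≡⟨ ℤₚ.pos-+ (suc n ℕ.* d) (n ℕ.* c) ⟩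
    + (suc n ℕ.* d) + + (n ℕ.* c)  ≡⟨ cong₂ _+_ (ℤₚ.pos-* (suc n) d) (ℤₚ.pos-* n c) ⟩
    + suc n * + d + + n * + c      ∎
  expand : ∀ m n f c → (m - n) * (f * c) ≡ f * (m * c) - f * (n * c)
  expand = solve-∀
  cancel : ∀ f s d e → f * (s * d + e) - f * e ≡ s * f * d
  cancel = solve-∀

signedStirling : ℕ → ℕ → ℤ
signedStirling n k = (- + 1) ^ (n ℕ.∸ k) * + stirling1 n k

stirling1-vanishes : ∀ {n k} → n < k → stirling1 n k ≡ 0
stirling1-vanishes {zero}  {suc k} _         = refl
stirling1-vanishes {suc n} {suc k} (s≤s n<k) =
  cong₂ ℕ._+_ (trans (cong (n ℕ.*_) (stirling1-vanishes (ℕₚ.m<n⇒m<1+n n<k))) (ℕₚ.*-zeroʳ n))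
              (stirling1-vanishes n<k)

signedStirling-vanishes : ∀ {n k} → n < k → signedStirling n k ≡ 0ℤ
signedStirling-vanishes {n} {k} n<k =
  trans (cong (λ s → (- + 1) ^ (n ℕ.∸ k) * + s) (stirling1-vanishes n<k))
        (ℤₚ.*-zeroʳ ((- + 1) ^ (n ℕ.∸ k)))

signedStirling-zero : ∀ n → + n * signedStirling n 0 ≡ 0ℤ
signedStirling-zero zero    = refl
signedStirling-zero (suc n) =
  trans (cong (+ suc n *_) (ℤₚ.*-zeroʳ ((- + 1) ^ suc n))) (ℤₚ.*-zeroʳ (+ suc n))

signedStirling-suc : ∀ n k →
  signedStirling (suc n) (suc k) ≡ signedStirling n k - + n * signedStirling n (suc k)
signedStirling-suc n k with k ℕ.<? n
... | yes k<n = begin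
  (- + 1) ^ (n ℕ.∸ k) * + (n ℕ.* s₁ ℕ.+ s₀)
    ≡⟨ cong₂ (λ e z → (- + 1) ^ e * z) (ℕₚ.+-∸-assoc 1 k<n)
             (trans (ℤₚ.pos-+ (n ℕ.* s₁) s₀) (cong (_+ + s₀) (ℤₚ.pos-* n s₁))) ⟩
  - + 1 * σ * (+ n * + s₁ + + s₀)
    ≡⟨ rearrange σ (+ n) (+ s₁) (+ s₀) ⟩
  - + 1 * σ * + s₀ - + n * (σ * + s₁)
    ≡⟨ cong (λ e → (- + 1) ^ e * + s₀ - + n * (σ * + s₁)) (ℕₚ.+-∸-assoc 1 k<n) ⟨
  (- + 1) ^ (n ℕ.∸ k) * + s₀ - + n * (σ * + s₁) ∎
  where
  s₀ = stirling1 n k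
  s₁ = stirling1 n (suc k)
  σ  = (- + 1) ^ (n ℕ.∸ suc k)
  rearrange : ∀ σ n s₁ s₀ → - + 1 * σ * (n * s₁ + s₀) ≡ - + 1 * σ * s₀ - n * (σ * s₁)
  rearrange = solve-∀
... | no k≮n = begin
  σ₀ * + (n ℕ.* stirling1 n (suc k) ℕ.+ stirling1 n k)
    ≡⟨ cong (λ s → σ₀ * + (n ℕ.* s ℕ.+ stirling1 n k)) (stirling1-vanishes n<1+k) ⟩
  σ₀ * + (n ℕ.* 0 ℕ.+ stirling1 n k)
    ≡⟨ cong (λ z → σ₀ * + (z ℕ.+ stirling1 n k)) (ℕₚ.*-zeroʳ n) ⟩
  σ₀ * + stirling1 n k
    ≡⟨ no-second-term (σ₀ * + stirling1 n k) (+ n) ⟩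
  σ₀ * + stirling1 n k - + n * 0ℤ
    ≡⟨ cong (λ z → σ₀ * + stirling1 n k - + n * z) (signedStirling-vanishes n<1+k) ⟨
  σ₀ * + stirling1 n k - + n * signedStirling n (suc k) ∎
  where
  σ₀ = (- + 1) ^ (n ℕ.∸ k)
  n<1+k : n < suc k
  n<1+k = s≤s (ℕₚ.≮⇒≥ k≮n)
  no-second-term : ∀ x m → x ≡ x - m * 0ℤ
  no-second-term = solve-∀

Σ≤-signedStirling-suc : ∀ n x →
  Σ≤ (suc n) (λ k → signedStirling (suc n) k * x ^ k)
    ≡ (x - + n) * Σ≤ n (λ k → signedStirling n k * x ^ k)
Σ≤-signedStirling-suc n x = begin
  Σ≤ (suc n) (λ k → signedStirling (suc n) k * x ^ k)
    ≡⟨ Σ≤-suc n _ ⟩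
  signedStirling (suc n) 0 * 1ℤ + Σ≤ n (λ k → signedStirling (suc n) (suc k) * x ^ suc k)
    ≡⟨ cong₂ _+_ (trans (ℤₚ.*-identityʳ _) (ℤₚ.*-zeroʳ ((- + 1) ^ suc n))) (Σ≤-cong n recurrence) ⟩
  0ℤ + Σ≤ n (λ k → x * g k + - + n * g (suc k))
    ≡⟨ ℤₚ.+-identityˡ _ ⟩
  Σ≤ n (λ k → x * g k + - + n * g (suc k))
    ≡⟨ Σ≤-distrib-+ n (λ k → x * g k) (λ k → - + n * g (suc k)) ⟩
  Σ≤ n (λ k → x * g k) + Σ≤ n (λ k → - + n * g (suc k))
    ≡⟨ cong₂ _+_ (*-distribˡ-Σ≤ x n g) (*-distribˡ-Σ≤ (- + n) n (g ∘ suc)) ⟨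
  x * P + - + n * Q
    ≡⟨ cong (λ p → x * p + - + n * Q) head+tail ⟨
  x * (g 0 + Q) + - + n * Q
    ≡⟨ regroup x (+ n) (g 0) Q ⟩
  (x - + n) * (g 0 + Q) + + n * g 0
    ≡⟨ cong₂ (λ p z → (x - + n) * p + z) head+tail
             (trans (sym (ℤₚ.*-assoc (+ n) (signedStirling n 0) 1ℤ)) (cong (_* 1ℤ) (signedStirling-zero n))) ⟩
  (x - + n) * P + 0ℤ
    ≡⟨ ℤₚ.+-identityʳ _ ⟩
  (x - + n) * P ∎
  where
  g : ℕ → ℤ
  g k = signedStirling n k * x ^ k
  P = Σ≤ n g
  Q = Σ≤ n (g ∘ suc)
  recurrence : ∀ k → signedStirling (suc n) (suc k) * x ^ suc k ≡ x * g k + - + n * g (suc k)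
  recurrence k =
    trans (cong (_* x ^ suc k) (signedStirling-suc n k)) (distribute (signedStirling n k) (+ n) _ x (x ^ k))
    where
    distribute : ∀ a m b x y → (a - m * b) * (x * y) ≡ x * (a * y) + - m * (b * (x * y))
    distribute = solve-∀
  head+tail : g 0 + Q ≡ P
  head+tail = begin
    g 0 + Q        ≡⟨ Σ≤-suc n g ⟨
    P + g (suc n)  ≡⟨ cong (_+_ P) (trans (cong (_* x ^ suc n) (signedStirling-vanishes (ℕₚ.n<1+n n)))
                                          (ℤₚ.*-zeroˡ (x ^ suc n))) ⟩
    P + 0ℤ         ≡⟨ ℤₚ.+-identityʳ P ⟩
    P              ∎
  regroup : ∀ x m g₀ q → x * (g₀ + q) + - m * q ≡ (x - m) * (g₀ + q) + m * g₀
  regroup = solve-∀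

Σ≤-signedStirling-falling : ∀ n x → Σ≤ n (λ k → signedStirling n k * x ^ k) ≡ falling x n
Σ≤-signedStirling-falling zero    x = refl
Σ≤-signedStirling-falling (suc n) x =
  trans (Σ≤-signedStirling-suc n x) (cong ((x - + n) *_) (Σ≤-signedStirling-falling n x))

Σ≤-signedStirling-ballots : ∀ n r c →
  Σ≤ n (λ k → signedStirling n k * + ballotCount k r * + ballotCount k c) ≡ + (n !) * + burgeCount n r c
Σ≤-signedStirling-ballots n r c = begin
  Σ≤ n (λ k → signedStirling n k * + ballotCount k r * + ballotCount k c)
    ≡⟨ Σ≤-cong n (λ k → trans (ℤₚ.*-assoc (signedStirling n k) _ _)
                        (trans (cong (signedStirling n k *_) (ballotCount-product k r c))
                               (*-distribˡ-∑∑ (signedStirling n k) (subsets r) (subsets c) _))) ⟩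
  Σ≤ n (λ k → ∑[ S ∈ subsets r ] ∑[ T ∈ subsets c ] signedStirling n k * (ε S T * free S T ^ k))
    ≡⟨ Σ≤-∑-comm n (subsets r) _ ⟩
  ∑[ S ∈ subsets r ] Σ≤ n (λ k → ∑[ T ∈ subsets c ] signedStirling n k * (ε S T * free S T ^ k))
    ≡⟨ ∑-cong (subsets r) (λ S → Σ≤-∑-comm n (subsets c) _) ⟩
  ∑[ S ∈ subsets r ] ∑[ T ∈ subsets c ] Σ≤ n (λ k → signedStirling n k * (ε S T * free S T ^ k))
    ≡⟨ ∑-cong (subsets r) (λ S → ∑-cong (subsets c) (λ T → term S T)) ⟩
  ∑[ S ∈ subsets r ] ∑[ T ∈ subsets c ] + (n !) * (ε S T * + ((falseCount S ℕ.* falseCount T) C n))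
    ≡⟨ *-distribˡ-∑∑ (+ (n !)) (subsets r) (subsets c) _ ⟨
  + (n !) * (∑[ S ∈ subsets r ] ∑[ T ∈ subsets c ] ε S T * + ((falseCount S ℕ.* falseCount T) C n))
    ≡⟨ cong (+ (n !) *_) (burgeCount-inclusion-exclusion n r c) ⟨
  + (n !) * + burgeCount n r c ∎
  where
  ε free : Vec Bool r → Vec Bool c → ℤ
  ε S T    = sign S * sign T
  free S T = + (falseCount S ℕ.* falseCount T)
  term : ∀ S T → Σ≤ n (λ k → signedStirling n k * (ε S T * free S T ^ k))
               ≡ + (n !) * (ε S T * + ((falseCount S ℕ.* falseCount T) C n))
  term S T = begin
    Σ≤ n (λ k → signedStirling n k * (ε S T * free S T ^ k))
      ≡⟨ Σ≤-cong n (λ k → x∙yz≈y∙xz (signedStirling n k) (ε S T) (free S T ^ k)) ⟩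
    Σ≤ n (λ k → ε S T * (signedStirling n k * free S T ^ k))
      ≡⟨ *-distribˡ-Σ≤ (ε S T) n _ ⟨
    ε S T * Σ≤ n (λ k → signedStirling n k * free S T ^ k)
      ≡⟨ cong (ε S T *_) (Σ≤-signedStirling-falling n (free S T)) ⟩
    ε S T * falling (free S T) n
      ≡⟨ cong (ε S T *_) (trans (falling-binomial _ n) (ℤₚ.pos-* (n !) _)) ⟩
    ε S T * (+ (n !) * + ((falseCount S ℕ.* falseCount T) C n))
      ≡⟨ x∙yz≈y∙xz (ε S T) (+ (n !)) _ ⟩
    + (n !) * (ε S T * + ((falseCount S ℕ.* falseCount T) C n)) ∎

burgeTerm-as-ballotTerms : ∀ n r c (s t : ℤ) →
  + (n !) * (+ burgeCount n r c * s ^ r * t ^ c)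
    ≡ Σ≤ n (λ k → signedStirling n k * (+ ballotCount k r * s ^ r) * (+ ballotCount k c * t ^ c))
burgeTerm-as-ballotTerms n r c s t = begin
  + (n !) * (+ burgeCount n r c * s ^ r * t ^ c)
    ≡⟨ pair-up (+ (n !)) (+ burgeCount n r c) (s ^ r) (t ^ c) ⟩
  + (n !) * + burgeCount n r c * (s ^ r * t ^ c)
    ≡⟨ cong (_* (s ^ r * t ^ c)) (Σ≤-signedStirling-ballots n r c) ⟨
  Σ≤ n (λ k → signedStirling n k * β k r * β k c) * (s ^ r * t ^ c)
    ≡⟨ *-distribʳ-Σ≤ _ n _ ⟩
  Σ≤ n (λ k → signedStirling n k * β k r * β k c * (s ^ r * t ^ c))
    ≡⟨ Σ≤-cong n (λ k → spread (signedStirling n k) (β k r) (β k c) (s ^ r) (t ^ c)) ⟩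
  Σ≤ n (λ k → signedStirling n k * (β k r * s ^ r) * (β k c * t ^ c)) ∎
  where
  β : ℕ → ℕ → ℤ
  β k b = + ballotCount k b
  pair-up : ∀ f b x y → f * (b * x * y) ≡ f * b * (x * y)
  pair-up = solve-∀
  spread : ∀ a p q x y → a * p * q * (x * y) ≡ a * (p * x) * (q * y)
  spread = solve-∀

mainTheorem12 : (n : ℕ) (s t : ℤ) → + (n !) * Bhat n s t ≡ rhsTimesFact n s t
mainTheorem12 n s t = begin
  + (n !) * Bhat n s t
    ≡⟨ trans (*-distribˡ-Σ≤ (+ (n !)) n _) (Σ≤-cong n (λ r → *-distribˡ-Σ≤ (+ (n !)) n (term r))) ⟩
  Σ≤ n (λ r → Σ≤ n (λ c → + (n !) * term r c))
    ≡⟨ Σ≤-cong n (λ r → Σ≤-cong n (λ c → burgeTerm-as-ballotTerms n r c s t)) ⟩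
  Σ≤ n (λ r → Σ≤ n (λ c → Σ≤ n (λ k → signedStirling n k * (β k r * s ^ r) * (β k c * t ^ c))))
    ≡⟨ Σ≤-bilinear n n (signedStirling n) (λ k r → β k r * s ^ r) (λ k c → β k c * t ^ c) ⟨
  Σ≤ n (λ k → signedStirling n k * Σ≤ n (λ r → β k r * s ^ r) * Σ≤ n (λ c → β k c * t ^ c))
    ≡⟨ Σ≤-cong-≤ n (λ k k≤n → cong₂ (λ p q → signedStirling n k * p * q)
                                    (Bal-extend s k≤n) (Bal-extend t k≤n)) ⟨
  rhsTimesFact n s t ∎
  where
  β : ℕ → ℕ → ℤ
  β k b = + ballotCount k b
  term : ℕ → ℕ → ℤ
  term r c = + burgeCount n r c * s ^ r * t ^ c
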